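{- Let $\overline{\mathsf{M}} = \langle I, \{S_{\Phi}\}_{\Phi \subseteq \mathsf{At}}, (r^{\Phi}_{\Psi})_{\Psi \subseteq \Phi \subseteq \mathsf{At}}, (\Pi_i)_{i \in I}, (\Lambda_i)_{i \in I}, v \rangle$ be a complemented HMS model. For any individual $i \in I$ and $\omega, \omega' \in \Omega$, if $\omega' \in \Pi_i(\omega)$, then $\Lambda_i(\omega') = \Pi_i(\omega')$.
   Context: Fix a nonempty set $\mathsf{At}$ of atomic formulas. An HMS model $\langle I, \{S_{\Phi}\}_{\Phi \subseteq \mathsf{At}}, (r^{\Phi}_{\Psi})_{\Psi \subseteq \Phi \subseteq \mathsf{At}}, (\Pi_i)_{i \in I}, v \rangle$ consists of: a nonempty set $I$ of individuals; for each $\Phi \subseteq \mathsf{At}$ a nonempty state space $S_\Phi$, the spaces pairwise disjoint and ordered by $S_\Psi \preceq S_\Phi$ iff $\Psi \subseteq \Phi$; $\Omega := \bigcup_{\Phi} S_\Phi$; surjections $r^\Phi_\Psi : S_\Phi \to S_\Psi$ for $\Psi \subseteq \Phi$ with $r^\Phi_\Phi$ the identity and $r^\Phi_\Upsilon = r^\Psi_\Upsilon \circ r^\Phi_\Psi$ for $\Upsilon \subseteq \Psi \subseteq \Phi$; possibility correspondences $\Pi_i : \Omega \to 2^\Omega \setminus \{\emptyset\}$; a valuation $v$ from $\mathsf{At}$ to events. Notation: $\omega_\Psi := r^\Phi_\Psi(\omega)$ for $\omega \in S_\Phi$, $\Psi\subseteq\Phi$; $D_\Psi := r^\Phi_\Psi(D)$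 for $D \subseteq S_\Phi$; for a space $S = S_\Psi$, $D_S := D_\Psi$; $D^{\uparrow} := \bigcup_{\Phi \subseteq \Psi \subseteq \mathsf{At}} (r^\Psi_\Phi)^{ -1}(D)$ for $D \subseteq S_\Phi$; $\Pi_i^\uparrow(\omega) := (\Pi_i(\omega))^\uparrow$; $S_{\Pi_i(\omega)}$ is the space containing $\Pi_i(\omega)$. Each $\Pi_i$ satisfies: Confinement (if $\omega \in S_\Phi$ then $\Pi_i(\omega) \subseteq S_\Psi$ for some $\Psi \subseteq \Phi$); Generalized Reflexivity ($\omega \in \Pi_i^\uparrow(\omega)$); Stationarity ($\omega' \in \Pi_i(\omega) \Rightarrow \Pi_i(\omega') = \Pi_i(\omega)$); Projections Preserve Ignorance (if $\omega \in S_\Phi$, $\Psi \subseteq \Phi$ then $\Pi_i^\uparrow(\omega) \subseteq \Pi_i^\uparrow(\omega_\Psi)$); Projections Preserve Knowledge (if $\Upsilon \subseteq \Psi \subseteq \Phi$, $\omega \in S_\Phi$, $\Pi_i(\omega) \subseteq S_\Psi$, then $(\Pi_i(\omega))_\Upsilon = \Pi_i(\omega_\Upsilon)$). A complemented HMS model additionally has, for each $i$, an implicit possibility correspondence $\Lambda_i : \Omega \to 2^\Omega$ satisfying: Reflexivity ($\omega \in \Lambda_i(\omega)$); Stationarity ($\omega' \in \Lambda_i(\omega) \Rightarrow \Lambda_i(\omega') = \Lambda_i(\omega)$); Projections Preserve Implicit Knowledge (if $\omega \in S_\Phi$ then $\Lambda_i(\omega)_\Psi = \Lambda_i(\omega_\Psi)$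 for all $\Psi \subseteq \Phi$); Explicit Measurability ($\omega' \in \Lambda_i(\omega) \Rightarrow \Pi_i(\omega') = \Pi_i(\omega)$); Implicit Measurability ($\omega' \in \Pi_i(\omega) \Rightarrow \Lambda_i(\omega') = \Lambda_i(\omega)_{S_{\Pi_i(\omega)}}$). -}

module Defs where

open import Data.Bool using (Bool; true)
open import Data.Product using (Σ; Σ-syntax; ∃; _×_; _,_; proj₁; proj₂)
open import Relation.Binary.PropositionalEquality using (_≡_; subst)

Sub : Set → Set
Sub At = At → Bool

_⊆ₐ_ : {At : Set} → Sub At → Sub At → Set
Ψ ⊆ₐ Φ = ∀ a → Ψ a ≡ true → Φ a ≡ true

-- The structural part of an HMS model: state spaces S_Φ and projections r^Φ_Ψ.
-- Ω := Σ Φ, S Φ (a disjoint union, so the spaces are pairwise disjoint).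
record Lattice (At : Set) : Set₁ where
  field
    S : Sub At → Set
    r : (Φ Ψ : Sub At) → Ψ ⊆ₐ Φ → S Φ → S Ψ

  Ω : Set
  Ω = Σ (Sub At) S

  PredΩ : Set₁
  PredΩ = Ω → Set

  _⊆S_ : PredΩ → Sub At → Set
  D ⊆S Ψ = ∀ x → D x → proj₁ x ≡ Ψ

  _⊆Ω_ : PredΩ → PredΩ → Set
  D ⊆Ω E = ∀ x → D x → E x

  _≐_ : PredΩ → PredΩ → Set
  D ≐ E = (D ⊆Ω E) × (E ⊆Ω D)

  proj : PredΩ → (Φ Ψ : Sub At) → Ψ ⊆ₐ Φ → PredΩ
  proj D Φ Ψ p x = Σ[ s ∈ S Φ ] (D (Φ , s) × (x ≡ (Ψ , r Φ Ψ p s)))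

  up : PredΩ → Sub At → PredΩ
  up D Φ (Ψ , s) = Σ[ p ∈ Φ ⊆ₐ Ψ ] D (Φ , r Ψ Φ p s)

record ComplementedHMS (At : Set) : Set₁ where
  field
    lattice : Lattice At
  open Lattice lattice public
  field
    atNonempty : At
    I : Set
    iNonempty : I
    SNonempty : ∀ Φ → S Φ
    r-surj : ∀ Φ Ψ (p : Ψ ⊆ₐ Φ) (t : S Ψ) → ∃ λ s → r Φ Ψ p s ≡ t
    r-id : ∀ Φ (p : Φ ⊆ₐ Φ) (s : S Φ) → r Φ Φ p s ≡ s
    r-comp : ∀ Φ Ψ Υ (p : Ψ ⊆ₐ Φ) (q : Υ ⊆ₐ Ψ) (pq : Υ ⊆ₐ Φ) (s : S Φ) →
             r Φ Υ pq s ≡ r Ψ Υ q (r Φ Ψ p s)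
    -- valuation: each atom is sent to an event (a subset of some space S_Φ)
    v : At → Σ[ Φ ∈ Sub At ] (S Φ → Set)

    Π : I → Ω → PredΩ
    Π-nonempty : ∀ i ω → ∃ λ x → Π i ω x
    confinement : ∀ i Φ (s : S Φ) → Σ[ Ψ ∈ Sub At ] (Ψ ⊆ₐ Φ × (Π i (Φ , s) ⊆S Ψ))
    -- ω ∈ Π_i^↑(ω)  (Ψ ranges over the space containing Π_i(ω))
    genReflexivity : ∀ i ω Ψ → Π i ω ⊆S Ψ → up (Π i ω) Ψ ω
    Π-stationarity : ∀ i ω ω' → Π i ω ω' → Π i ω' ≐ Π i ω
    ppIgnorance : ∀ i Φ Ψ (p : Ψ ⊆ₐ Φ) (s : S Φ) Υ Υ' →
                  Π i (Φ , s) ⊆S Υ → Π i (Ψ , r Φ Ψ p s) ⊆S Υ' →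
                  up (Π i (Φ , s)) Υ ⊆Ω up (Π i (Ψ , r Φ Ψ p s)) Υ'
    ppKnowledge : ∀ i Φ Ψ Υ (q : Υ ⊆ₐ Ψ) (p : Υ ⊆ₐ Φ) (s : S Φ) →
                  Ψ ⊆ₐ Φ → Π i (Φ , s) ⊆S Ψ →
                  proj (Π i (Φ , s)) Ψ Υ q ≐ Π i (Υ , r Φ Υ p s)

    Λ : I → Ω → PredΩ
    -- well-formedness implicit in the notation Λ_i(ω)_Ψ: Λ_i(ω) ⊆ S_Φ for ω ∈ S_Φ
    Λ-confined : ∀ i Φ (s : S Φ) → Λ i (Φ , s) ⊆S Φ
    Λ-reflexivity : ∀ i ω → Λ i ω ω
    Λ-stationarity : ∀ i ω ω' → Λ i ω ω' → Λ i ω' ≐ Λ i ω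
    ppImplicitKnowledge : ∀ i Φ Ψ (p : Ψ ⊆ₐ Φ) (s : S Φ) →
                  proj (Λ i (Φ , s)) Φ Ψ p ≐ Λ i (Ψ , r Φ Ψ p s)
    explicitMeasurability : ∀ i ω ω' → Λ i ω ω' → Π i ω' ≐ Π i ω
    implicitMeasurability : ∀ i Φ (s : S Φ) ω' Ψ (p : Ψ ⊆ₐ Φ) →
                  Π i (Φ , s) ω' → Π i (Φ , s) ⊆S Ψ →
                  Λ i ω' ≐ proj (Λ i (Φ , s)) Φ Ψ p

-- Fix ω' ∈ Π_i(ω) and let S_Ψ be the space of Π_i(ω). By stationarity Π_i(ω') = Π_i(ω), so
-- ω' ∈ S_Ψ and Π_i(ω') ⊆ S_Ψ. Implicit measurability makes Λ_i constant (= Λ_i(ω)_Ψ) on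
-- Π_i(ω), so every x ∈ Π_i(ω') lies in Λ_i(x) = Λ_i(ω'). Conversely, for x ∈ Λ_i(ω') explicit
-- measurability gives Π_i(x) = Π_i(ω') ⊆ S_Ψ, and x ∈ S_Ψ too; generalized reflexivity
-- restricted to the bottom space S_Ψ of Π_i^↑(x) is plain reflexivity, so x ∈ Π_i(x) = Π_i(ω').
module Submission where

open import Defs
open import Data.Product using (_,_; proj₁; proj₂)
open import Relation.Binary.PropositionalEquality using (_≡_; subst; sym; trans)

module _ {At : Set} (M : ComplementedHMS At) where
  open ComplementedHMS M

  up-base : (D : PredΩ) (Ψ : Sub At) (t : S Ψ) → up D Ψ (Ψ , t) → D (Ψ , t)
  up-base D Ψ t (p , d) = subst (λ u → D (Ψ , u)) (r-id Ψ p t) d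

  Π-reflexive-in-own-space : ∀ i x → Π i x ⊆S proj₁ x → Π i x x
  Π-reflexive-in-own-space i (Ψ , t) conf =
    up-base (Π i (Ψ , t)) Ψ t (genReflexivity i (Ψ , t) Ψ conf)

  Λ-space : ∀ i ω x → Λ i ω x → proj₁ x ≡ proj₁ ω
  Λ-space i (Φ , s) = Λ-confined i Φ s

  Π-member-space : ∀ i ω ω' → Π i ω ω' → Π i ω' ⊆S proj₁ ω'
  Π-member-space i (Φ , s) ω' h y hy =
    trans (conf y (proj₁ (Π-stationarity i (Φ , s) ω' h) y hy)) (sym (conf ω' h))
    where
      conf : Π i (Φ , s) ⊆S proj₁ (confinement i Φ s)
      conf = proj₂ (proj₂ (confinement i Φ s))

  Λ-constant-on-Π : ∀ i ω x y → Π i ω x → Π i ω y → Λ i x ⊆Ω Λ i y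
  Λ-constant-on-Π i (Φ , s) x y hx hy z hz =
    proj₂ (measurable y hy) z (proj₁ (measurable x hx) z hz)
    where
      Ψ : Sub At
      Ψ = proj₁ (confinement i Φ s)
      Ψ⊆Φ : Ψ ⊆ₐ Φ
      Ψ⊆Φ = proj₁ (proj₂ (confinement i Φ s))
      measurable : ∀ x → Π i (Φ , s) x → Λ i x ≐ proj (Λ i (Φ , s)) Φ Ψ Ψ⊆Φ
      measurable x h =
        implicitMeasurability i Φ s x Ψ Ψ⊆Φ h (proj₂ (proj₂ (confinement i Φ s)))

  Π⊆Λ : ∀ i ω ω' → Π i ω ω' → Π i ω' ⊆Ω Λ i ω'
  Π⊆Λ i ω ω' h x hx =
    Λ-constant-on-Π i ω x ω' (proj₁ (Π-stationarity i ω ω' h) x hx) h x (Λ-reflexivity i x)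

  Λ⊆Π : ∀ i ω ω' → Π i ω ω' → Λ i ω' ⊆Ω Π i ω'
  Λ⊆Π i ω ω' h x hx = proj₁ sameΠ x (Π-reflexive-in-own-space i x confined)
    where
      sameΠ : Π i x ≐ Π i ω'
      sameΠ = explicitMeasurability i ω' x hx
      confined : Π i x ⊆S proj₁ x
      confined y hy =
        trans (Π-member-space i ω ω' h y (proj₁ sameΠ y hy)) (sym (Λ-space i ω' x hx))

lemma5 : {At : Set} (M : ComplementedHMS At) →
    let open ComplementedHMS M in
    (i : I) (ω ω' : Ω) → Π i ω ω' → Λ i ω' ≐ Π i ω'
lemma5 M i ω ω' h = Λ⊆Π M i ω ω' h , Π⊆Λ M i ω ω' h
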